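{- Let $N \geq 3$ be an odd integer and let $a_1, \ldots, a_M$ be a sequence of integers with $M \geq 4N$. Then there exists a subsequence $a_{k_1}, \ldots, a_{k_L}$ (with $1 \le k_1 < \cdots < k_L \le M$) of length $L > N$ such that the number of sub-subsequences of $a_{k_1}, \ldots, a_{k_L}$ whose sum of elements is congruent to $0$ modulo $N$ is at least $2^L/N$.
   Context: A subsequence of a finite sequence is determined by a subset of its index positions; sub-subsequences of $a_{k_1},\ldots,a_{k_L}$ are counted as subsets $S \subseteq \{1,\ldots,L\}$ of positions (so there are $2^L$ of them in total, including the empty one, whose sum is $0$), and the sum of elements of the sub-subsequence indexed by $S$ is $\sum_{j \in S} a_{k_j}$. -}

module Defs where

open import Data.Nat using (ℕ; zero; suc)
open import Data.Integer using (ℤ; _+_; 0ℤ; +_)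
open import Data.Integer.Divisibility.Signed using (_∣_; _∣?_)
open import Data.Bool using (Bool; true; false; if_then_else_)
open import Data.Vec using (Vec; []; _∷_; lookup)
open import Data.Fin using (Fin; _<_)
open import Data.List using (List; []; _∷_; map; _++_; length; filter)

-- A subsequence of a : Fin M → ℤ is given by strictly increasing indices k : Fin L → Fin M.
StrictlyIncreasing : ∀ {L M} → (Fin L → Fin M) → Set
StrictlyIncreasing {L} k = ∀ (i j : Fin L) → i < j → k i < k j

allSubsets : (L : ℕ) → List (Vec Bool L)
allSubsets zero = [] ∷ []
allSubsets (suc L) = map (false ∷_) (allSubsets L) ++ map (true ∷_) (allSubsets L)

subsetSum : ∀ {L} → Vec Bool L → Vec ℤ L → ℤ
subsetSum [] [] = 0ℤ
subsetSum (s ∷ S) (x ∷ xs) = (if s then x else 0ℤ) + subsetSum S xs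

countZeroMod : ∀ {L} → ℕ → Vec ℤ L → ℕ
countZeroMod {L} N b = length (filter (λ S → (+ N) ∣? subsetSum S b) (allSubsets L))

module Submission where

-- For a list xs of integers and c : ℤ let cnt xs c be the number of
-- sub-multisets S of xs with N ∣ c + ΣS.  Suppose xs = x₁ … x_q and ys = y₁ … y_q
-- satisfy xᵢ ≡ yᵢ (mod N) and Σ ys ≡ 0 (mod N).  Writing g(s) for the number of
-- sub-multisets of xs with sum ≡ s, splitting a subset of xs ++ ys into its two
-- parts gives cnt (xs ++ ys) 0 = Σ_s g(s) · g(-s), and complementation inside ys
-- (using Σ ys ≡ 0) turns g(-s) into g(s).  Hence the count is Σ_s g(s)², which by
-- Cauchy–Schwarz is at least (Σ_s g(s))² / N = 4^q / N = 2^(2q) / N.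
--
-- It therefore suffices to find such xs, ys inside the sequence with 2q > N.  Among
-- any N + 1 integers two are congruent, so a greedy pass splits the M ≥ 4N terms
-- into congruent pairs plus at most N leftovers.  Among any N pairs the prefix sums
-- of the second components collide, giving a block of pairs whose second components
-- sum to 0 mod N; a second greedy pass keeps all but fewer than N pairs.  Counting
-- shows that more than N/2 pairs survive.

open import Defs
open import Data.Nat using (ℕ; _*_; _^_; _≤_; _<_; _%_)
open import Data.Integer using (ℤ)
open import Data.Fin using (Fin)
open import Data.Vec using (tabulate)
open import Data.Product using (Σ; _×_)
open import Relation.Binary.PropositionalEquality using (_≡_)

open import Data.Nat using (zero; suc; _+_; NonZero; >-nonZero; z≤n; s≤s; _≤?_; pred)
open import Data.Nat.Properties
import Data.Nat.Tactic.RingSolver as ℕ-Solver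
open import Algebra.Properties.CommutativeSemigroup +-commutativeSemigroup using (interchange)
open import Data.Integer using (+_; -[1+_]; 0ℤ; _/ℕ_; _%ℕ_)
  renaming (_+_ to _+ᶻ_; _-_ to _-ᶻ_; -_ to -ᶻ_; _*_ to _*ᶻ_)
import Data.Integer.Properties as ℤP
open import Data.Integer.DivMod using (n%ℕd<d; a≡a%ℕn+[a/ℕn]*n)
open import Data.Integer.Divisibility.Signed using (_∣_; _∣?_; divides; ∣-refl; ∣m⇒∣-m; ∣m∣n⇒∣m+n; ∣m∣n⇒∣m-n; ∣⇒∣ᵤ)
import Data.Nat.Divisibility as ℕ∣
import Data.Integer.Tactic.RingSolver as ℤ-Solver
open import Data.Fin using (fromℕ<; toℕ) renaming (zero to fzero; suc to fsuc)
open import Data.Fin.Properties using (pigeonhole; toℕ-fromℕ<; toℕ<n)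
open import Data.Vec as Vec using (Vec)
open import Data.List as List using (List; []; _∷_; _++_; length; map; filter; take; drop; concatMap)
import Data.List.Properties as LP
open import Data.List.Relation.Binary.Permutation.Propositional as Perm using (_↭_; ↭-refl; ↭-sym; ↭-trans; ↭-reflexive)
import Data.List.Relation.Binary.Permutation.Propositional.Properties as PermP
open import Data.List.Relation.Binary.Sublist.Propositional using (_⊆_; []; _∷_; _∷ʳ_)
import Data.List.Membership.Propositional.Properties as ∈P
open import Data.List.Relation.Unary.Any using (here)
open import Data.Product using (_,_)
open import Data.Sum using (inj₁; inj₂)
open import Data.Empty using (⊥-elim)
open import Relation.Nullary using (Dec; yes; no; ¬_)
open import Relation.Binary.PropositionalEquality using (refl; sym; trans; cong; cong₂; subst; subst₂; module ≡-Reasoning)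
open import Function using (_∘_)
open import Data.Bool using (Bool; true; false)

bit : {P : Set} → Dec P → ℕ
bit (yes _) = 1
bit (no _)  = 0

bit-yes : {P : Set} (d : Dec P) → P → bit d ≡ 1
bit-yes (yes _) _ = refl
bit-yes (no ¬p) p = ⊥-elim (¬p p)

bit-no : {P : Set} (d : Dec P) → ¬ P → bit d ≡ 0
bit-no (yes p) ¬p = ⊥-elim (¬p p)
bit-no (no _)  _  = refl

bit-⇔ : {P Q : Set} (p : Dec P) (q : Dec Q) → (P → Q) → (Q → P) → bit p ≡ bit q
bit-⇔ (yes _) (yes _) _ _ = refl
bit-⇔ (no _)  (no _)  _ _ = refl
bit-⇔ (yes p) (no ¬q) f _ = ⊥-elim (¬q (f p))
bit-⇔ (no ¬p) (yes q) _ g = ⊥-elim (¬p (g q))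

sumTo : ℕ → (ℕ → ℕ) → ℕ
sumTo zero    g = 0
sumTo (suc n) g = sumTo n g + g n

sumTo-cong : ∀ n {g h : ℕ → ℕ} → (∀ s → g s ≡ h s) → sumTo n g ≡ sumTo n h
sumTo-cong zero    e = refl
sumTo-cong (suc n) e = cong₂ _+_ (sumTo-cong n e) (e n)

sumTo-+ : ∀ n (g h : ℕ → ℕ) → sumTo n (λ s → g s + h s) ≡ sumTo n g + sumTo n h
sumTo-+ zero    g h = refl
sumTo-+ (suc n) g h =
  trans (cong (_+ (g n + h n)) (sumTo-+ n g h)) (interchange (sumTo n g) (sumTo n h) (g n) (h n))

sumTo-*ˡ : ∀ n a (g : ℕ → ℕ) → sumTo n (λ s → a * g s) ≡ a * sumTo n g
sumTo-*ˡ zero    a g = sym (*-zeroʳ a)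
sumTo-*ˡ (suc n) a g = trans (cong (_+ a * g n) (sumTo-*ˡ n a g)) (sym (*-distribˡ-+ a (sumTo n g) (g n)))

sumTo-*ʳ : ∀ n a (g : ℕ → ℕ) → sumTo n (λ s → g s * a) ≡ sumTo n g * a
sumTo-*ʳ n a g = trans (sumTo-cong n (λ s → *-comm (g s) a)) (trans (sumTo-*ˡ n a g) (*-comm a _))

sumTo-const : ∀ n a → sumTo n (λ _ → a) ≡ n * a
sumTo-const zero    a = refl
sumTo-const (suc n) a = trans (cong (_+ a) (sumTo-const n a)) (+-comm (n * a) a)

sumTo-mono : ∀ n {g h : ℕ → ℕ} → (∀ s → g s ≤ h s) → sumTo n g ≤ sumTo n h
sumTo-mono zero    e = z≤n
sumTo-mono (suc n) e = +-mono-≤ (sumTo-mono n e) (e n)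

sumTo-rotate : ∀ n (g : ℕ → ℕ) → sumTo n (g ∘ suc) + g 0 ≡ sumTo n g + g n
sumTo-rotate zero    g = refl
sumTo-rotate (suc n) g = begin
    (sumTo n (g ∘ suc) + g (suc n)) + g 0  ≡⟨ +-assoc (sumTo n (g ∘ suc)) _ _ ⟩
    sumTo n (g ∘ suc) + (g (suc n) + g 0)  ≡⟨ cong (λ z → sumTo n (g ∘ suc) + z) (+-comm (g (suc n)) (g 0)) ⟩
    sumTo n (g ∘ suc) + (g 0 + g (suc n))  ≡⟨ sym (+-assoc (sumTo n (g ∘ suc)) _ _) ⟩
    (sumTo n (g ∘ suc) + g 0) + g (suc n)  ≡⟨ cong (_+ g (suc n)) (sumTo-rotate n g) ⟩
    (sumTo n g + g n) + g (suc n)          ∎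
  where open ≡-Reasoning

-- 2ab ≤ a² + b² when a ≤ b: writing b = a + d, the difference is d².
twoProduct≤squares-ordered : ∀ {a b} → a ≤ b → a * b + a * b ≤ a * a + b * b
twoProduct≤squares-ordered {a} a≤b with d , refl ← m≤n⇒∃[o]m+o≡n a≤b =
  subst (a * (a + d) + a * (a + d) ≤_) (sym (expand a d)) (m≤m+n _ (d * d))
  where
  expand : ∀ a d → a * a + (a + d) * (a + d) ≡ (a * (a + d) + a * (a + d)) + d * d
  expand = ℕ-Solver.solve-∀

twoProduct≤squares : ∀ a b → a * b + a * b ≤ a * a + b * b
twoProduct≤squares a b with ≤-total a b
... | inj₁ a≤b = twoProduct≤squares-ordered a≤b
... | inj₂ b≤a = subst₂ _≤_ (cong₂ _+_ (*-comm b a) (*-comm b a)) (+-comm (b * b) (a * a))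
                         (twoProduct≤squares-ordered b≤a)

-- Cauchy–Schwarz:  (Σ g)² ≤ n · Σ g².  Summing 2·g i·g j ≤ g i² + g j² over all
-- pairs (i, j) gives 2 (Σ g)² ≤ 2 n Σ g².
cauchySchwarz : ∀ n (g : ℕ → ℕ) → sumTo n g * sumTo n g ≤ n * sumTo n (λ s → g s * g s)
cauchySchwarz n g = *-cancelˡ-≤ 2 doubled
  where
  S = sumTo n g
  Q = sumTo n (λ s → g s * g s)
  open ≡-Reasoning
  products : sumTo n (λ i → sumTo n (λ j → g i * g j + g i * g j)) ≡ 2 * (S * S)
  products = begin
      sumTo n (λ i → sumTo n (λ j → g i * g j + g i * g j))
    ≡⟨ sumTo-cong n (λ i → sumTo-+ n (λ j → g i * g j) (λ j → g i * g j)) ⟩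
      sumTo n (λ i → sumTo n (λ j → g i * g j) + sumTo n (λ j → g i * g j))
    ≡⟨ sumTo-cong n (λ i → cong₂ _+_ (sumTo-*ˡ n (g i) g) (sumTo-*ˡ n (g i) g)) ⟩
      sumTo n (λ i → g i * S + g i * S)
    ≡⟨ sumTo-+ n _ _ ⟩
      sumTo n (λ i → g i * S) + sumTo n (λ i → g i * S)
    ≡⟨ cong₂ _+_ (sumTo-*ʳ n S g) (sumTo-*ʳ n S g) ⟩
      S * S + S * S
    ≡⟨ cong (λ z → S * S + z) (sym (+-identityʳ (S * S))) ⟩
      2 * (S * S) ∎
  squares : sumTo n (λ i → sumTo n (λ j → g i * g i + g j * g j)) ≡ 2 * (n * Q)
  squares = begin
      sumTo n (λ i → sumTo n (λ j → g i * g i + g j * g j))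
    ≡⟨ sumTo-cong n (λ i → sumTo-+ n (λ j → g i * g i) (λ j → g j * g j)) ⟩
      sumTo n (λ i → sumTo n (λ j → g i * g i) + Q)
    ≡⟨ sumTo-+ n _ _ ⟩
      sumTo n (λ i → sumTo n (λ j → g i * g i)) + sumTo n (λ i → Q)
    ≡⟨ cong₂ _+_ (sumTo-cong n (λ i → sumTo-const n (g i * g i))) (sumTo-const n Q) ⟩
      sumTo n (λ i → n * (g i * g i)) + n * Q
    ≡⟨ cong (_+ n * Q) (sumTo-*ˡ n n (λ i → g i * g i)) ⟩
      n * Q + n * Q
    ≡⟨ cong (λ z → n * Q + z) (sym (+-identityʳ (n * Q))) ⟩
      2 * (n * Q) ∎
  doubled : 2 * (S * S) ≤ 2 * (n * Q)
  doubled = subst₂ _≤_ products squares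
              (sumTo-mono n (λ i → sumTo-mono n (λ j → twoProduct≤squares (g i) (g j))))

nth : {A : Set} → A → List A → ℕ → A
nth x₀ []       _       = x₀
nth x₀ (x ∷ xs) zero    = x
nth x₀ (x ∷ xs) (suc i) = nth x₀ xs i

pickOne : ∀ {A : Set} (x₀ : A) w j → j < length w → Σ (List A) λ w′ → w ↭ nth x₀ w j ∷ w′
pickOne x₀ (x ∷ xs) zero    _         = xs , ↭-refl
pickOne x₀ (x ∷ xs) (suc j) (s≤s j<n) with w′ , p ← pickOne x₀ xs j j<n =
  x ∷ w′ , ↭-trans (Perm.prep x p) (Perm.swap x (nth x₀ xs j) ↭-refl)

pickTwo : ∀ {A : Set} (x₀ : A) w i j → i < j → j < length w →
  Σ (List A) λ w′ → w ↭ nth x₀ w i ∷ nth x₀ w j ∷ w′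
pickTwo x₀ (x ∷ xs) zero    (suc j) _         (s≤s j<n) with w′ , p ← pickOne x₀ xs j j<n =
  w′ , Perm.prep x p
pickTwo x₀ (x ∷ xs) (suc i) (suc j) (s≤s i<j) (s≤s j<n) with w′ , p ← pickTwo x₀ xs i j i<j j<n =
  x ∷ w′ , ↭-trans (Perm.prep x p) (↭-trans (Perm.swap x (nth x₀ xs i) ↭-refl)
                                            (Perm.prep (nth x₀ xs i) (Perm.swap x (nth x₀ xs j) ↭-refl)))

segment : ∀ {A : Set} (xs : List A) i j → i < j → j ≤ length xs →
  Σ (List A) λ B → Σ (List A) λ rest → take i xs ++ B ≡ take j xs × xs ↭ B ++ rest × 1 ≤ length B
segment (x ∷ xs) zero (suc j) _ _ =
  take (suc j) (x ∷ xs) , drop (suc j) (x ∷ xs) , refl ,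
  ↭-reflexive (sym (LP.take++drop≡id (suc j) (x ∷ xs))) , s≤s z≤n
segment (x ∷ xs) (suc i) (suc j) (s≤s i<j) (s≤s j≤n) with B , rest , pre , p , nonempty ← segment xs i j i<j j≤n =
  B , x ∷ rest , cong (x ∷_) pre , ↭-trans (Perm.prep x p) (↭-sym (PermP.shift x B rest)) , nonempty

↭-shorter : ∀ {A : Set} {xs ys zs : List A} → xs ↭ ys ++ zs → 1 ≤ length ys → length zs < length xs
↭-shorter {ys = ys} {zs} p nonempty =
  subst (length zs <_) (sym (trans (PermP.↭-length p) (LP.length-++ ys))) (+-monoˡ-≤ (length zs) nonempty)

greedy : ∀ {A B : Set} (chunk : B → List A) k →
  (∀ xs → k ≤ length xs → Σ B λ b → Σ (List A) λ rest → xs ↭ chunk b ++ rest × 1 ≤ length (chunk b)) →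
  ∀ xs → Σ (List B) λ bs → Σ (List A) λ rest → xs ↭ concatMap chunk bs ++ rest × length rest < k
greedy {A} {B} chunk k split xs = go (suc (length xs)) xs ≤-refl
  where
  go : ∀ fuel xs → length xs < fuel →
    Σ (List B) λ bs → Σ (List A) λ rest → xs ↭ concatMap chunk bs ++ rest × length rest < k
  go (suc fuel) xs bound with k ≤? length xs
  ... | no short = [] , xs , ↭-refl , ≰⇒> short
  ... | yes long with b , rest , p , nonempty ← split xs long
                 with bs , rest′ , p′ , small ← go fuel rest (≤-trans (↭-shorter {ys = chunk b} p nonempty) (≤-pred bound)) =
    b ∷ bs , rest′ ,
    ↭-trans p (↭-trans (PermP.++⁺ˡ (chunk b) p′) (↭-sym (PermP.++-assoc (chunk b) (concatMap chunk bs) rest′))) ,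
    small

concatMap-↭ : ∀ {A B : Set} (f : A → List B) {xs ys} → xs ↭ ys → concatMap f xs ↭ concatMap f ys
concatMap-↭ f Perm.refl          = ↭-refl
concatMap-↭ f (Perm.prep x p)    = PermP.++⁺ˡ (f x) (concatMap-↭ f p)
concatMap-↭ f (Perm.swap x y p)  =
  ↭-trans (PermP.shifts (f x) (f y)) (PermP.++⁺ˡ (f y) (PermP.++⁺ˡ (f x) (concatMap-↭ f p)))
concatMap-↭ f (Perm.trans p q)   = ↭-trans (concatMap-↭ f p) (concatMap-↭ f q)

drop-∷-inFirst : ∀ {A : Set} {x : A} {xs} ys₁ ys₂ zs →
  x ∷ xs ↭ (ys₁ ++ x ∷ ys₂) ++ zs → xs ↭ (ys₁ ++ ys₂) ++ zs
drop-∷-inFirst ys₁ ys₂ zs p =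
  ↭-trans (PermP.drop-mid [] ys₁ (↭-trans p (↭-reflexive (LP.++-assoc ys₁ (_ ∷ ys₂) zs))))
          (↭-reflexive (sym (LP.++-assoc ys₁ ys₂ zs)))

drop-∷-inSecond : ∀ {A : Set} {x : A} {xs} ys zs₁ zs₂ →
  x ∷ xs ↭ ys ++ zs₁ ++ x ∷ zs₂ → xs ↭ ys ++ zs₁ ++ zs₂
drop-∷-inSecond ys zs₁ zs₂ p =
  ↭-trans (PermP.drop-mid [] (ys ++ zs₁) (↭-trans p (↭-reflexive (sym (LP.++-assoc ys zs₁ (_ ∷ zs₂))))))
          (↭-reflexive (LP.++-assoc ys zs₁ zs₂))

-- If xs is a permutation of ys ++ zs, some sublist of xs is a permutation of ys:
-- walk along xs, keeping an entry if it is taken from ys and skipping it otherwise.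
sublist-↭ : ∀ {A : Set} (xs ys zs : List A) → xs ↭ ys ++ zs → Σ (List A) λ S → S ⊆ xs × S ↭ ys
sublist-↭ [] [] zs p = [] , [] , ↭-refl
sublist-↭ [] (y ∷ ys) zs p with () ← PermP.↭-empty-inv (↭-sym p)
sublist-↭ (x ∷ xs) ys zs p with ∈P.∈-++⁻ ys (PermP.∈-resp-↭ p (here refl))
... | inj₁ x∈ys with ys₁ , ys₂ , refl ← ∈P.∈-∃++ x∈ys
                with S , S⊆xs , S↭ ← sublist-↭ xs (ys₁ ++ ys₂) zs (drop-∷-inFirst ys₁ ys₂ zs p) =
  x ∷ S , refl ∷ S⊆xs , ↭-trans (Perm.prep x S↭) (↭-sym (PermP.shift x ys₁ ys₂))
... | inj₂ x∈zs with zs₁ , zs₂ , refl ← ∈P.∈-∃++ x∈zs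
                with S , S⊆xs , S↭ ← sublist-↭ xs ys (zs₁ ++ zs₂) (drop-∷-inSecond ys zs₁ zs₂ p) =
  S , x ∷ʳ S⊆xs , S↭

sublist⇒indices : ∀ {A : Set} {M} (a : Fin M → A) {S} → S ⊆ List.tabulate a →
  Σ (Fin (length S) → Fin M) λ k → StrictlyIncreasing k × List.tabulate (a ∘ k) ≡ S
sublist⇒indices {M = zero}  a []         = (λ ()) , (λ ()) , refl
sublist⇒indices {M = suc M} a (_ ∷ʳ sub) with k , increasing , image ← sublist⇒indices (a ∘ fsuc) sub =
  fsuc ∘ k , (λ i j i<j → s≤s (increasing i j i<j)) , image
sublist⇒indices {M = suc M} a {_ ∷ S} (refl ∷ sub) with k , increasing , image ← sublist⇒indices (a ∘ fsuc) sub =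
  k′ , increasing′ , cong (a fzero ∷_) image
  where
  k′ : Fin (suc (length S)) → Fin (suc M)
  k′ fzero    = fzero
  k′ (fsuc i) = fsuc (k i)
  increasing′ : StrictlyIncreasing k′
  increasing′ fzero    (fsuc j) _         = s≤s z≤n
  increasing′ (fsuc i) (fsuc j) (s≤s i<j) = s≤s (increasing i j i<j)

toList-tabulate : ∀ {A : Set} {n} (f : Fin n → A) → Vec.toList (Vec.tabulate f) ≡ List.tabulate f
toList-tabulate {n = zero}  f = refl
toList-tabulate {n = suc n} f = cong (f fzero ∷_) (toList-tabulate (f ∘ fsuc))

module ModN (N : ℕ) {{_ : NonZero N}} where

  infix 4 _≈_

  -- Congruence modulo N.  A record (rather than a synonym) so that both integers
  -- can be recovered from a proof by unification.
  record _≈_ (c d : ℤ) : Set where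
    constructor mk≈
    field N∣difference : + N ∣ c -ᶻ d
  open _≈_

  N∣0 : + N ∣ 0ℤ
  N∣0 = divides 0ℤ refl

  ≈-by : ∀ {c d c′ d′} → c -ᶻ d ≡ c′ -ᶻ d′ → c ≈ d → c′ ≈ d′
  ≈-by e (mk≈ p) = mk≈ (subst (+ N ∣_) e p)

  ≈-sym : ∀ {c d} → c ≈ d → d ≈ c
  ≈-sym {c} {d} (mk≈ p) = mk≈ (subst (+ N ∣_) (negate c d) (∣m⇒∣-m p))
    where
    negate : ∀ c d → -ᶻ (c -ᶻ d) ≡ d -ᶻ c
    negate = ℤ-Solver.solve-∀

  ≈-+ʳ : ∀ {c d} x → c ≈ d → c +ᶻ x ≈ d +ᶻ x
  ≈-+ʳ {c} {d} x = ≈-by (shift c d x)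
    where
    shift : ∀ c d x → c -ᶻ d ≡ (c +ᶻ x) -ᶻ (d +ᶻ x)
    shift = ℤ-Solver.solve-∀

  ≈-+ˡ : ∀ {c d} x → c ≈ d → x +ᶻ c ≈ x +ᶻ d
  ≈-+ˡ {c} {d} x = ≈-by (shift c d x)
    where
    shift : ∀ c d x → c -ᶻ d ≡ (x +ᶻ c) -ᶻ (x +ᶻ d)
    shift = ℤ-Solver.solve-∀

  ≈-neg : ∀ {c d} → c ≈ d → -ᶻ c ≈ -ᶻ d
  ≈-neg {c} {d} c≈d = ≈-by (negate c d) (≈-sym c≈d)
    where
    negate : ∀ c d → d -ᶻ c ≡ (-ᶻ c) -ᶻ (-ᶻ d)
    negate = ℤ-Solver.solve-∀

  N≈0 : + N ≈ 0ℤ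
  N≈0 = mk≈ (subst (+ N ∣_) (sym (ℤP.+-identityʳ (+ N))) ∣-refl)

  ∣-resp-≈ : ∀ {c d} → c ≈ d → + N ∣ c → + N ∣ d
  ∣-resp-≈ {c} {d} (mk≈ c-d) N∣c = subst (+ N ∣_) (cancel c d) (∣m∣n⇒∣m-n N∣c c-d)
    where
    cancel : ∀ c d → c -ᶻ (c -ᶻ d) ≡ d
    cancel = ℤ-Solver.solve-∀

  ind : ℤ → ℕ
  ind c = bit (+ N ∣? c)

  ind-cong : ∀ {c d} → c ≈ d → ind c ≡ ind d
  ind-cong {c} {d} c≈d = bit-⇔ (+ N ∣? c) (+ N ∣? d) (∣-resp-≈ c≈d) (∣-resp-≈ (≈-sym c≈d))

  ind-neg : ∀ c → ind (-ᶻ c) ≡ ind c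
  ind-neg c = bit-⇔ (+ N ∣? (-ᶻ c)) (+ N ∣? c)
    (λ p → subst (+ N ∣_) (ℤP.neg-involutive c) (∣m⇒∣-m p)) ∣m⇒∣-m

  sumᶻ : List ℤ → ℤ
  sumᶻ = List.foldr _+ᶻ_ 0ℤ

  sumᶻ-++ : ∀ xs ys → sumᶻ (xs ++ ys) ≡ sumᶻ xs +ᶻ sumᶻ ys
  sumᶻ-++ []       ys = sym (ℤP.+-identityˡ _)
  sumᶻ-++ (x ∷ xs) ys = trans (cong (x +ᶻ_) (sumᶻ-++ xs ys)) (sym (ℤP.+-assoc x _ _))

  -- cnt xs c is the number of sub-multisets S of xs (counted by position) with
  -- N ∣ c + ΣS: a subset either omits or contains the head x.
  cnt : List ℤ → ℤ → ℕ
  cnt []       c = ind c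
  cnt (x ∷ xs) c = cnt xs c + cnt xs (c +ᶻ x)

  cnt-cong : ∀ xs {c d} → c ≈ d → cnt xs c ≡ cnt xs d
  cnt-cong []       c≈d = ind-cong c≈d
  cnt-cong (x ∷ xs) c≈d = cong₂ _+_ (cnt-cong xs c≈d) (cnt-cong xs (≈-+ʳ x c≈d))

  cnt-↭ : ∀ {xs ys} → xs ↭ ys → ∀ c → cnt xs c ≡ cnt ys c
  cnt-↭ Perm.refl          c = refl
  cnt-↭ (Perm.prep x p)    c = cong₂ _+_ (cnt-↭ p c) (cnt-↭ p (c +ᶻ x))
  cnt-↭ (Perm.trans p q)   c = trans (cnt-↭ p c) (cnt-↭ q c)
  cnt-↭ {x ∷ y ∷ xs} {y ∷ x ∷ ys} (Perm.swap x y p) c = begin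
      (A c + A (c +ᶻ y)) + (A (c +ᶻ x) + A (c +ᶻ x +ᶻ y))
    ≡⟨ cong (λ u → (A c + A (c +ᶻ y)) + (A (c +ᶻ x) + A u)) (add-swap c x y) ⟩
      (A c + A (c +ᶻ y)) + (A (c +ᶻ x) + A (c +ᶻ y +ᶻ x))
    ≡⟨ interchange (A c) (A (c +ᶻ y)) (A (c +ᶻ x)) (A (c +ᶻ y +ᶻ x)) ⟩
      (A c + A (c +ᶻ x)) + (A (c +ᶻ y) + A (c +ᶻ y +ᶻ x))
    ≡⟨ cong₂ _+_ (cong₂ _+_ (cnt-↭ p c) (cnt-↭ p (c +ᶻ x)))
                 (cong₂ _+_ (cnt-↭ p (c +ᶻ y)) (cnt-↭ p (c +ᶻ y +ᶻ x))) ⟩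
      cnt (y ∷ x ∷ ys) c ∎
    where
    open ≡-Reasoning
    A = cnt xs
    add-swap : ∀ c x y → c +ᶻ x +ᶻ y ≡ c +ᶻ y +ᶻ x
    add-swap = ℤ-Solver.solve-∀

  -- Complementation S ↦ ys ∖ S: the number of subsets of ys with sum ≡ -c equals
  -- the number with sum ≡ c + Σ ys.
  cnt-complement : ∀ ys c → cnt ys c ≡ cnt ys (-ᶻ (c +ᶻ sumᶻ ys))
  cnt-complement [] c = sym (trans (cong ind (cong -ᶻ_ (ℤP.+-identityʳ c))) (ind-neg c))
  cnt-complement (y ∷ ys) c = begin
      cnt ys c + cnt ys (c +ᶻ y)
    ≡⟨ cong₂ _+_ (cnt-complement ys c) (cnt-complement ys (c +ᶻ y)) ⟩
      cnt ys (-ᶻ (c +ᶻ sumᶻ ys)) + cnt ys (-ᶻ (c +ᶻ y +ᶻ sumᶻ ys))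
    ≡⟨ cong₂ _+_ (cong (cnt ys) (omit c y (sumᶻ ys))) (cong (cnt ys) (keep c y (sumᶻ ys))) ⟩
      cnt ys (r +ᶻ y) + cnt ys r
    ≡⟨ +-comm (cnt ys (r +ᶻ y)) (cnt ys r) ⟩
      cnt (y ∷ ys) r ∎
    where
    open ≡-Reasoning
    r = -ᶻ (c +ᶻ (y +ᶻ sumᶻ ys))
    omit : ∀ c y s → -ᶻ (c +ᶻ s) ≡ -ᶻ (c +ᶻ (y +ᶻ s)) +ᶻ y
    omit = ℤ-Solver.solve-∀
    keep : ∀ c y s → -ᶻ (c +ᶻ y +ᶻ s) ≡ -ᶻ (c +ᶻ (y +ᶻ s))
    keep = ℤ-Solver.solve-∀

  record CongPair : Set where
    constructor congPair
    field
      fst snd : ℤ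
      fst≈snd : fst ≈ snd

  firsts seconds : List CongPair → List ℤ
  firsts  = map CongPair.fst
  seconds = map CongPair.snd

  cnt-firsts≡seconds : ∀ ps c → cnt (firsts ps) c ≡ cnt (seconds ps) c
  cnt-firsts≡seconds []                      c = refl
  cnt-firsts≡seconds (congPair x y x≈y ∷ ps) c = cong₂ _+_ (cnt-firsts≡seconds ps c)
    (trans (cnt-firsts≡seconds ps (c +ᶻ x)) (cnt-cong (seconds ps) (≈-+ˡ c x≈y)))

  Periodic : (ℤ → ℕ) → Set
  Periodic f = ∀ {c d} → c ≈ d → f c ≡ f d

  -- Summing a periodic function over the residue system 0, …, N-1 is invariant under
  -- translation: first by a natural number, using one rotation per unit step …
  sum-translate-ℕ : ∀ k f → Periodic f → sumTo N (λ s → f (+ s +ᶻ + k)) ≡ sumTo N (λ s → f (+ s))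
  sum-translate-ℕ zero    f periodic = sumTo-cong N (λ s → cong f (ℤP.+-identityʳ (+ s)))
  sum-translate-ℕ (suc k) f periodic = begin
      sumTo N (λ s → f (+ s +ᶻ + suc k))
    ≡⟨ sumTo-cong N (λ s → cong (f ∘ +_) (+-suc s k)) ⟩
      sumTo N (h ∘ suc)
    ≡⟨ +-cancelʳ-≡ (h 0) _ _ (trans (sumTo-rotate N h) (cong (λ z → sumTo N h + z) hN≡h0)) ⟩
      sumTo N h
    ≡⟨ sum-translate-ℕ k f periodic ⟩
      sumTo N (λ s → f (+ s)) ∎
    where
    open ≡-Reasoning
    h : ℕ → ℕ
    h s = f (+ s +ᶻ + k)
    hN≡h0 : h N ≡ h 0
    hN≡h0 = periodic (≈-+ʳ (+ k) N≈0)

  -- … and then by an arbitrary integer, undoing a negative shift by a positive one.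
  sum-translate : ∀ t f → Periodic f → sumTo N (λ s → f (+ s +ᶻ t)) ≡ sumTo N (λ s → f (+ s))
  sum-translate (+ k)      = sum-translate-ℕ k
  sum-translate -[1+ k ] f periodic = sym (trans
      (sym (sumTo-cong N (λ s → cong f (undo (+ s) (+ suc k)))))
      (sum-translate-ℕ (suc k) (λ c → f (c +ᶻ -[1+ k ])) (λ c≈d → periodic (≈-+ʳ -[1+ k ] c≈d))))
    where
    undo : ∀ a b → a +ᶻ b +ᶻ -ᶻ b ≡ a
    undo = ℤ-Solver.solve-∀

  -- Among 0, …, N-1 only s = 0 is divisible by N, so weighting by ind (-s) picks out h 0.
  sum-delta : ∀ (h : ℕ → ℕ) → sumTo N (λ s → ind (-ᶻ + s) * h s) ≡ h 0
  sum-delta h = subst (λ n → sumTo n g ≡ h 0) (suc-pred N) (prefix (pred N) (≤-reflexive (suc-pred N)))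
    where
    g : ℕ → ℕ
    g s = ind (-ᶻ + s) * h s
    prefix : ∀ m → m < N → sumTo (suc m) g ≡ h 0
    prefix zero    _    = trans (cong (_* h 0) (bit-yes (+ N ∣? 0ℤ) N∣0)) (+-identityʳ (h 0))
    prefix (suc m) m<N  = trans (cong (λ z → sumTo (suc m) g + z * h (suc m)) (bit-no (+ N ∣? (-ᶻ + suc m)) N∤))
                                (trans (+-identityʳ _) (prefix m (<-trans (n<1+n m) m<N)))
      where
      N∤ : ¬ (+ N ∣ -ᶻ + suc m)
      N∤ N∣ = <⇒≱ m<N (ℕ∣.∣⇒≤ (∣⇒∣ᵤ N∣))

  -- ofSum as u is the number of subsets of as whose sum is congruent to u.
  ofSum : List ℤ → ℤ → ℕ
  ofSum as u = cnt as (-ᶻ u)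

  ofSum-periodic : ∀ as → Periodic (ofSum as)
  ofSum-periodic as c≈d = cnt-cong as (≈-neg c≈d)

  -- Convolution: a subset of as ++ bs splits into a subset of as with sum ≡ s and a
  -- subset of bs, for a unique residue s.
  cnt-++ : ∀ as bs c → cnt (as ++ bs) c ≡ sumTo N (λ s → ofSum as (+ s) * cnt bs (c +ᶻ + s))
  cnt-++ []       bs c = sym (trans (sum-delta (λ s → cnt bs (c +ᶻ + s))) (cong (cnt bs) (ℤP.+-identityʳ c)))
  cnt-++ (a ∷ as) bs c = begin
      cnt (as ++ bs) c + cnt (as ++ bs) (c +ᶻ a)
    ≡⟨ cong₂ _+_ (cnt-++ as bs c) (cnt-++ as bs (c +ᶻ a)) ⟩
      sumTo N P + sumTo N (λ s → G (+ s))
    ≡⟨ cong (λ z → sumTo N P + z) (sym (sum-translate (-ᶻ a) G G-periodic)) ⟩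
      sumTo N P + sumTo N (λ s → G (+ s +ᶻ -ᶻ a))
    ≡⟨ cong (λ z → sumTo N P + z) (sumTo-cong N (λ s →
          cong₂ _*_ (cong (cnt as) (unshift (+ s) a)) (cong (cnt bs) (reshift c a (+ s))))) ⟩
      sumTo N P + sumTo N R
    ≡⟨ sym (sumTo-+ N P R) ⟩
      sumTo N (λ s → P s + R s)
    ≡⟨ sumTo-cong N (λ s → sym (*-distribʳ-+ (cnt bs (c +ᶻ + s)) (ofSum as (+ s)) (cnt as (-ᶻ + s +ᶻ a)))) ⟩
      sumTo N (λ s → ofSum (a ∷ as) (+ s) * cnt bs (c +ᶻ + s)) ∎
    where
    open ≡-Reasoning
    P R : ℕ → ℕ
    P s = ofSum as (+ s) * cnt bs (c +ᶻ + s)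
    R s = cnt as (-ᶻ + s +ᶻ a) * cnt bs (c +ᶻ + s)
    G : ℤ → ℕ
    G u = ofSum as u * cnt bs (c +ᶻ a +ᶻ u)
    G-periodic : Periodic G
    G-periodic c≈d = cong₂ _*_ (ofSum-periodic as c≈d) (cnt-cong bs (≈-+ˡ (c +ᶻ a) c≈d))
    unshift : ∀ s a → -ᶻ (s +ᶻ -ᶻ a) ≡ -ᶻ s +ᶻ a
    unshift = ℤ-Solver.solve-∀
    reshift : ∀ c a s → c +ᶻ a +ᶻ (s +ᶻ -ᶻ a) ≡ c +ᶻ s
    reshift = ℤ-Solver.solve-∀

  -- Every one of the 2^|as| subsets has its sum in exactly one residue class.
  ofSum-total : ∀ as → sumTo N (λ s → ofSum as (+ s)) ≡ 2 ^ length as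
  ofSum-total [] = trans (sumTo-cong N (λ s → sym (*-identityʳ _))) (sum-delta (λ _ → 1))
  ofSum-total (a ∷ as) = begin
      sumTo N (λ s → ofSum as (+ s) + cnt as (-ᶻ + s +ᶻ a))
    ≡⟨ sumTo-+ N _ _ ⟩
      T + sumTo N (λ s → cnt as (-ᶻ + s +ᶻ a))
    ≡⟨ cong (λ z → T + z) (sumTo-cong N (λ s → cong (cnt as) (sym (unshift (+ s) a)))) ⟩
      T + sumTo N (λ s → ofSum as (+ s +ᶻ -ᶻ a))
    ≡⟨ cong (λ z → T + z) (sum-translate (-ᶻ a) (ofSum as) (ofSum-periodic as)) ⟩
      T + T
    ≡⟨ cong₂ _+_ (ofSum-total as) (trans (ofSum-total as) (sym (+-identityʳ _))) ⟩
      2 ^ length (a ∷ as) ∎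
    where
    open ≡-Reasoning
    T = sumTo N (λ s → ofSum as (+ s))
    unshift : ∀ s a → -ᶻ (s +ᶻ -ᶻ a) ≡ -ᶻ s +ᶻ a
    unshift = ℤ-Solver.solve-∀

  -- The second-moment bound: if the second components of the congruent pairs ps sum
  -- to 0 mod N, then cnt (firsts ++ seconds) 0 = Σ_s g(s)² with Σ_s g(s) = 2^|ps|,
  -- where g s = ofSum (firsts ps) s; Cauchy–Schwarz gives 2^(2|ps|) ≤ N · cnt.
  secondMoment : ∀ ps → + N ∣ sumᶻ (seconds ps) →
    2 ^ (length ps + length ps) ≤ N * cnt (firsts ps ++ seconds ps) 0ℤ
  secondMoment ps N∣Σ = subst₂ _≤_ total² (cong (N *_) (sym squares)) (cauchySchwarz N g)
    where
    open ≡-Reasoning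
    xs ys : List ℤ
    xs = firsts ps
    ys = seconds ps
    g : ℕ → ℕ
    g s = ofSum xs (+ s)
    -- complementation inside ys (whose sum is ≡ 0) and congruence with xs
    mirror : ∀ s → cnt ys (+ s) ≡ g s
    mirror s = begin
        cnt ys (+ s)                    ≡⟨ cnt-complement ys (+ s) ⟩
        cnt ys (-ᶻ (+ s +ᶻ sumᶻ ys))    ≡⟨ cnt-cong ys (≈-neg (mk≈ (subst (+ N ∣_) (add-sub (+ s) (sumᶻ ys)) N∣Σ))) ⟩
        cnt ys (-ᶻ + s)                 ≡⟨ sym (cnt-firsts≡seconds ps (-ᶻ + s)) ⟩
        g s                             ∎
      where
      add-sub : ∀ a b → b ≡ a +ᶻ b -ᶻ a
      add-sub = ℤ-Solver.solve-∀
    squares : cnt (xs ++ ys) 0ℤ ≡ sumTo N (λ s → g s * g s)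
    squares = trans (cnt-++ xs ys 0ℤ) (sumTo-cong N (λ s → cong (g s *_) (mirror s)))
    total² : sumTo N g * sumTo N g ≡ 2 ^ (length ps + length ps)
    total² = begin
        sumTo N g * sumTo N g         ≡⟨ cong₂ _*_ (ofSum-total xs) (ofSum-total xs) ⟩
        2 ^ length xs * 2 ^ length xs ≡⟨ sym (^-distribˡ-+-* 2 (length xs) (length xs)) ⟩
        2 ^ (length xs + length xs)   ≡⟨ cong (λ n → 2 ^ (n + n)) (LP.length-map CongPair.fst ps) ⟩
        2 ^ (length ps + length ps)   ∎

  residue : ℤ → Fin N
  residue c = fromℕ< (n%ℕd<d c N)

  residue-≈ : ∀ c d → residue c ≡ residue d → c ≈ d
  residue-≈ c d same = mk≈ (divides (c /ℕ N -ᶻ d /ℕ N) difference)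
    where
    open ≡-Reasoning
    same% : c %ℕ N ≡ d %ℕ N
    same% = trans (sym (toℕ-fromℕ< (n%ℕd<d c N))) (trans (cong toℕ same) (toℕ-fromℕ< (n%ℕd<d d N)))
    factor : ∀ r q₁ q₂ n → (r +ᶻ q₁ *ᶻ n) -ᶻ (r +ᶻ q₂ *ᶻ n) ≡ (q₁ -ᶻ q₂) *ᶻ n
    factor = ℤ-Solver.solve-∀
    difference : c -ᶻ d ≡ (c /ℕ N -ᶻ d /ℕ N) *ᶻ + N
    difference = begin
        c -ᶻ d
      ≡⟨ cong₂ _-ᶻ_ (a≡a%ℕn+[a/ℕn]*n c N) (a≡a%ℕn+[a/ℕn]*n d N) ⟩
        (+ (c %ℕ N) +ᶻ c /ℕ N *ᶻ + N) -ᶻ (+ (d %ℕ N) +ᶻ d /ℕ N *ᶻ + N)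
      ≡⟨ cong (λ r → (+ r +ᶻ c /ℕ N *ᶻ + N) -ᶻ (+ (d %ℕ N) +ᶻ d /ℕ N *ᶻ + N)) same% ⟩
        (+ (d %ℕ N) +ᶻ c /ℕ N *ᶻ + N) -ᶻ (+ (d %ℕ N) +ᶻ d /ℕ N *ᶻ + N)
      ≡⟨ factor (+ (d %ℕ N)) (c /ℕ N) (d /ℕ N) (+ N) ⟩
        (c /ℕ N -ᶻ d /ℕ N) *ᶻ + N ∎

  collision : (f : ℕ → ℤ) → Σ ℕ λ i → Σ ℕ λ j → i < j × j ≤ N × f i ≈ f j
  collision f with i , j , i<j , same ← pigeonhole (n<1+n N) (residue ∘ f ∘ toℕ) =
    toℕ i , toℕ j , i<j , ≤-pred (toℕ<n j) , residue-≈ _ _ same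

  pairList : CongPair → List ℤ
  pairList (congPair x y _) = x ∷ y ∷ []

  splitCongPair : ∀ w → suc N ≤ length w →
    Σ CongPair λ p → Σ (List ℤ) λ rest → w ↭ pairList p ++ rest × 1 ≤ length (pairList p)
  splitCongPair w N<w =
    let (i , j , i<j , j≤N , wᵢ≈wⱼ) = collision (nth 0ℤ w)
        (rest , w↭)                 = pickTwo 0ℤ w i j i<j (≤-<-trans j≤N N<w)
    in congPair _ _ wᵢ≈wⱼ , rest , w↭ , s≤s z≤n

  record ZeroBlock : Set where
    constructor zeroBlock
    field
      pairs   : List CongPair
      zeroSum : + N ∣ sumᶻ (seconds pairs)
  open ZeroBlock

  prefixSum : List CongPair → ℕ → ℤ
  prefixSum ps i = sumᶻ (seconds (take i ps))

  zeroSum-between : ∀ ps i j B → take i ps ++ B ≡ take j ps →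
    prefixSum ps i ≈ prefixSum ps j → + N ∣ sumᶻ (seconds B)
  zeroSum-between ps i j B split same = subst (+ N ∣_) difference (N∣difference (≈-sym same))
    where
    open ≡-Reasoning
    P = prefixSum ps i
    cancel : ∀ a b → a +ᶻ b -ᶻ a ≡ b
    cancel = ℤ-Solver.solve-∀
    difference : prefixSum ps j -ᶻ P ≡ sumᶻ (seconds B)
    difference = begin
        sumᶻ (seconds (take j ps)) -ᶻ P              ≡⟨ cong (λ l → sumᶻ (seconds l) -ᶻ P) (sym split) ⟩
        sumᶻ (seconds (take i ps ++ B)) -ᶻ P         ≡⟨ cong (λ l → sumᶻ l -ᶻ P) (LP.map-++ CongPair.snd (take i ps) B) ⟩
        sumᶻ (seconds (take i ps) ++ seconds B) -ᶻ P ≡⟨ cong (_-ᶻ P) (sumᶻ-++ (seconds (take i ps)) (seconds B)) ⟩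
        P +ᶻ sumᶻ (seconds B) -ᶻ P                   ≡⟨ cancel P _ ⟩
        sumᶻ (seconds B)                             ∎

  -- Davenport's argument: any N congruent pairs contain a zero-sum block,
  -- since two of the N + 1 prefix sums collide.
  splitZeroBlock : ∀ ps → N ≤ length ps →
    Σ ZeroBlock λ b → Σ (List CongPair) λ rest → ps ↭ pairs b ++ rest × 1 ≤ length (pairs b)
  splitZeroBlock ps N≤ps =
    let (i , j , i<j , j≤N , same)            = collision (prefixSum ps)
        (B , rest , split , ps↭ , nonempty) = segment ps i j i<j (≤-trans j≤N N≤ps)
    in zeroBlock B (zeroSum-between ps i j B split same) , rest , ps↭ , nonempty

  concat-zeroSum : ∀ bs → + N ∣ sumᶻ (seconds (concatMap pairs bs))
  concat-zeroSum []       = N∣0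
  concat-zeroSum (b ∷ bs) = subst (+ N ∣_) (sym sum-split) (∣m∣n⇒∣m+n (zeroSum b) (concat-zeroSum bs))
    where
    sum-split : sumᶻ (seconds (pairs b ++ concatMap pairs bs)) ≡ sumᶻ (seconds (pairs b)) +ᶻ sumᶻ (seconds (concatMap pairs bs))
    sum-split = trans (cong sumᶻ (LP.map-++ CongPair.snd (pairs b) _)) (sumᶻ-++ (seconds (pairs b)) (seconds (concatMap pairs bs)))

  pairs-↭ : ∀ ps → concatMap pairList ps ↭ firsts ps ++ seconds ps
  pairs-↭ []                    = ↭-refl
  pairs-↭ (congPair x y _ ∷ ps) =
    Perm.prep x (↭-trans (Perm.prep y (pairs-↭ ps)) (↭-sym (PermP.shift y (firsts ps) (seconds ps))))

  length-firsts++seconds : ∀ ps → length (firsts ps ++ seconds ps) ≡ length ps + length ps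
  length-firsts++seconds ps = trans (LP.length-++ (firsts ps))
    (cong₂ _+_ (LP.length-map CongPair.fst ps) (LP.length-map CongPair.snd ps))

  rearrange : ∀ {w ps R} qs rs → w ↭ concatMap pairList ps ++ R → ps ↭ qs ++ rs →
    w ↭ (firsts qs ++ seconds qs) ++ (concatMap pairList rs ++ R)
  rearrange {w} {ps} {R} qs rs w↭ ps↭ = begin
      w                                                     ↭⟨ w↭ ⟩
      concatMap pairList ps ++ R                            ↭⟨ PermP.++⁺ʳ R (concatMap-↭ pairList ps↭) ⟩
      concatMap pairList (qs ++ rs) ++ R                    ≡⟨ cong (_++ R) (LP.concatMap-++ pairList qs rs) ⟩
      (concatMap pairList qs ++ concatMap pairList rs) ++ R ≡⟨ LP.++-assoc (concatMap pairList qs) _ R ⟩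
      concatMap pairList qs ++ (concatMap pairList rs ++ R) ↭⟨ PermP.++⁺ʳ _ (pairs-↭ qs) ⟩
      (firsts qs ++ seconds qs) ++ (concatMap pairList rs ++ R) ∎
    where open Perm.PermutationReasoning

  -- The bookkeeping: 4N ≤ |w| = 2|ps| + |R| with |R| ≤ N, and |ps| = |qs| + |rs| with
  -- |rs| < N, force N + 2 ≤ 2|qs|.
  enoughPairs : ∀ {m p r q s} → 4 * N ≤ m → m ≡ (p + p) + r → r ≤ N → p ≡ q + s → s < N → N < q + q
  enoughPairs {m} {p} {r} {q} {s} 4N≤m m≡ r≤N p≡ s<N =
    ≤-trans (n≤1+n (suc N)) (+-cancelʳ-≤ (3 * N) (suc (suc N)) (q + q) chain)
    where
    open ≤-Reasoning
    chain : suc (suc N) + 3 * N ≤ q + q + 3 * N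
    chain = begin
      suc (suc N) + 3 * N          ≡⟨ expand₁ N ⟩
      4 * N + 2                    ≤⟨ +-monoˡ-≤ 2 4N≤m ⟩
      m + 2                        ≡⟨ cong (λ x → x + 2) m≡ ⟩
      p + p + r + 2                ≤⟨ +-monoˡ-≤ 2 (+-monoʳ-≤ (p + p) r≤N) ⟩
      p + p + N + 2                ≡⟨ cong (λ x → x + x + N + 2) p≡ ⟩
      (q + s) + (q + s) + N + 2    ≡⟨ expand₂ q s N ⟩
      q + q + (suc s + suc s + N)  ≤⟨ +-monoʳ-≤ (q + q) (+-monoˡ-≤ N (+-mono-≤ s<N s<N)) ⟩
      q + q + (N + N + N)          ≡⟨ cong (λ x → q + q + x) (expand₃ N) ⟩
      q + q + 3 * N                ∎
      where
      expand₁ : ∀ N → suc (suc N) + 3 * N ≡ 4 * N + 2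
      expand₁ = ℕ-Solver.solve-∀
      expand₂ : ∀ q s N → (q + s) + (q + s) + N + 2 ≡ q + q + (suc s + suc s + N)
      expand₂ = ℕ-Solver.solve-∀
      expand₃ : ∀ N → N + N + N ≡ 3 * N
      expand₃ = ℕ-Solver.solve-∀

  -- Every list w of at least 4N integers contains, up to order, the components of a
  -- list qs of congruent pairs with zero-sum second components and N < 2|qs|: greedily
  -- split w into congruent pairs, then greedily group the pairs into zero-sum blocks.
  goodPairs : ∀ w → 4 * N ≤ length w →
    Σ (List CongPair) λ qs → Σ (List ℤ) λ rest →
      w ↭ (firsts qs ++ seconds qs) ++ rest × + N ∣ sumᶻ (seconds qs) × N < length qs + length qs
  goodPairs w 4N≤w =
    let (ps , R , w↭ , R≤N)    = greedy pairList (suc N) splitCongPair w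
        (bs , rs , ps↭ , rs<N) = greedy pairs N splitZeroBlock ps
        qs                     = concatMap pairs bs
        |w| : length w ≡ (length ps + length ps) + length R
        |w| = trans (PermP.↭-length (↭-trans w↭ (PermP.++⁺ʳ R (pairs-↭ ps))))
                    (trans (LP.length-++ (firsts ps ++ seconds ps)) (cong (_+ length R) (length-firsts++seconds ps)))
        |ps| : length ps ≡ length qs + length rs
        |ps| = trans (PermP.↭-length ps↭) (LP.length-++ qs)
    in qs , concatMap pairList rs ++ R , rearrange qs rs w↭ ps↭ , concat-zeroSum bs ,
       enoughPairs 4N≤w |w| (≤-pred R≤N) |ps| rs<N

  #divisible : {A : Set} → (A → ℤ) → List A → ℕ
  #divisible e xs = length (filter (λ x → + N ∣? e x) xs)

  #divisible-∷ : ∀ {A : Set} (e : A → ℤ) x xs → #divisible e (x ∷ xs) ≡ ind (e x) + #divisible e xs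
  #divisible-∷ e x xs with + N ∣? e x
  ... | yes N∣ = cong length (LP.filter-accept (λ y → + N ∣? e y) N∣)
  ... | no N∤  = cong length (LP.filter-reject (λ y → + N ∣? e y) N∤)

  #divisible-++ : ∀ {A : Set} (e : A → ℤ) xs ys → #divisible e (xs ++ ys) ≡ #divisible e xs + #divisible e ys
  #divisible-++ e xs ys = trans (cong length (LP.filter-++ (λ x → + N ∣? e x) xs ys)) (LP.length-++ (filter _ xs))

  #divisible-map : ∀ {A B : Set} (e : B → ℤ) (f : A → B) xs → #divisible e (map f xs) ≡ #divisible (e ∘ f) xs
  #divisible-map e f []       = refl
  #divisible-map e f (x ∷ xs) =
    trans (#divisible-∷ e (f x) (map f xs))
          (trans (cong (λ n → ind (e (f x)) + n) (#divisible-map e f xs)) (sym (#divisible-∷ (e ∘ f) x xs)))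

  #divisible-cong : ∀ {A : Set} {e e′ : A → ℤ} → (∀ x → e x ≡ e′ x) → ∀ xs → #divisible e xs ≡ #divisible e′ xs
  #divisible-cong {e = e} {e′} e≗e′ xs = cong length
    (LP.filter-≐ (λ x → + N ∣? e x) (λ x → + N ∣? e′ x)
                 ((λ {x} → subst (+ N ∣_) (e≗e′ x)) , (λ {x} → subst (+ N ∣_) (sym (e≗e′ x)))) xs)

  #divisible-subsets : ∀ {L} (b : Vec ℤ L) c → #divisible (λ S → c +ᶻ subsetSum S b) (allSubsets L) ≡ cnt (Vec.toList b) c
  #divisible-subsets Vec.[] c =
    trans (#divisible-∷ (λ S → c +ᶻ subsetSum S Vec.[]) Vec.[] []) (trans (+-identityʳ _) (cong ind (ℤP.+-identityʳ c)))
  #divisible-subsets {suc L} (x Vec.∷ xs) c = begin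
      #divisible e (map (false Vec.∷_) A ++ map (true Vec.∷_) A)
    ≡⟨ #divisible-++ e (map (false Vec.∷_) A) (map (true Vec.∷_) A) ⟩
      #divisible e (map (false Vec.∷_) A) + #divisible e (map (true Vec.∷_) A)
    ≡⟨ cong₂ _+_ (#divisible-map e (false Vec.∷_) A) (#divisible-map e (true Vec.∷_) A) ⟩
      #divisible (e ∘ (false Vec.∷_)) A + #divisible (e ∘ (true Vec.∷_)) A
    ≡⟨ cong₂ _+_ (#divisible-cong (λ S → cong (c +ᶻ_) (ℤP.+-identityˡ (subsetSum S xs))) A)
                 (#divisible-cong (λ S → sym (ℤP.+-assoc c x (subsetSum S xs))) A) ⟩
      #divisible (λ S → c +ᶻ subsetSum S xs) A + #divisible (λ S → c +ᶻ x +ᶻ subsetSum S xs) A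
    ≡⟨ cong₂ _+_ (#divisible-subsets xs c) (#divisible-subsets xs (c +ᶻ x)) ⟩
      cnt (Vec.toList (x Vec.∷ xs)) c ∎
    where
    open ≡-Reasoning
    A = allSubsets L
    e : Vec Bool (suc L) → ℤ
    e S = c +ᶻ subsetSum S (x Vec.∷ xs)

  countZeroMod≡cnt : ∀ {L} (b : Vec ℤ L) → countZeroMod N b ≡ cnt (Vec.toList b) 0ℤ
  countZeroMod≡cnt {L} b =
    trans (#divisible-cong (λ S → sym (ℤP.+-identityˡ (subsetSum S b))) (allSubsets L)) (#divisible-subsets b 0ℤ)

  count-subsequence : ∀ {M} (a : Fin M → ℤ) qs {S} → S ↭ firsts qs ++ seconds qs →
    (k : Fin (length S) → Fin M) → List.tabulate (a ∘ k) ≡ S →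
    countZeroMod N (tabulate (λ i → a (k i))) ≡ cnt (firsts qs ++ seconds qs) 0ℤ
  count-subsequence a qs {S} S↭ k image = begin
      countZeroMod N (tabulate (a ∘ k))        ≡⟨ countZeroMod≡cnt (tabulate (a ∘ k)) ⟩
      cnt (Vec.toList (tabulate (a ∘ k))) 0ℤ   ≡⟨ cong (λ l → cnt l 0ℤ) (trans (toList-tabulate (a ∘ k)) image) ⟩
      cnt S 0ℤ                                 ≡⟨ cnt-↭ S↭ 0ℤ ⟩
      cnt (firsts qs ++ seconds qs) 0ℤ         ∎
    where open ≡-Reasoning

  manyZeroSums : ∀ M → 4 * N ≤ M → (a : Fin M → ℤ) →
    Σ ℕ λ L → Σ (Fin L → Fin M) λ k →
      StrictlyIncreasing k × N < L × 2 ^ L ≤ N * countZeroMod N (tabulate (λ i → a (k i)))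
  manyZeroSums M 4N≤M a =
    let w                           = List.tabulate a
        (qs , rest , w↭ , N∣Σ , N<) = goodPairs w (subst (4 * N ≤_) (sym (LP.length-tabulate a)) 4N≤M)
        (S , S⊆w , S↭)              = sublist-↭ w (firsts qs ++ seconds qs) rest w↭
        (k , increasing , image)    = sublist⇒indices a S⊆w
        |S| : length S ≡ length qs + length qs
        |S| = trans (PermP.↭-length S↭) (length-firsts++seconds qs)
    in length S , k , increasing , subst (N <_) (sym |S|) N< ,
       subst₂ _≤_ (cong (2 ^_) (sym |S|)) (cong (N *_) (sym (count-subsequence a qs S↭ k image))) (secondMoment qs N∣Σ)

-- The statement asks only for odd N ≥ 3; the argument needs just N ≥ 1.
theorem1 : (N : ℕ) → 3 ≤ N → N % 2 ≡ 1 →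
    (M : ℕ) → 4 * N ≤ M → (a : Fin M → ℤ) →
    Σ ℕ λ L → Σ (Fin L → Fin M) λ k →
      StrictlyIncreasing k × N < L ×
      2 ^ L ≤ N * countZeroMod N (tabulate (λ i → a (k i)))
theorem1 N 3≤N _ = ModN.manyZeroSums N {{>-nonZero (≤-trans (s≤s z≤n) 3≤N)}}
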